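{- For every integer $n\geq 1$, \[ \tilde{A}_n(p,q)=(1+pq)^{\lfloor n/2\rfloor}A_n\Big(\frac{p+q}{1+pq},0\Big). \] Equivalently, for every $n\ge 0$, \[ A_{2n+1}(p,q)=(1+pq)^{n}A_{2n+1}\Big(0,\frac{p+q}{1+pq}\Big),\qquad A_{2n+2}(p,q)=(1+p)(1+pq)^{n}A_{2n+2}\Big(0,\frac{p+q}{1+pq}\Big). \]
   Context: $\mathfrak{S}_n$ is the set of permutations of $[n]$. For $\pi=a_1\cdots a_n\in\mathfrak{S}_n$, an index $i\in[n-1]$ is a descent if $a_i>a_{i+1}$; $\mathrm{odes}(\pi)$ (resp. $\mathrm{edes}(\pi)$) is the number of descents at odd (resp. even) positions $i$. $A_n(p,q)=\sum_{\pi\in\mathfrak{S}_n}p^{\mathrm{odes}(\pi)}q^{\mathrm{edes}(\pi)}$ for $n\ge1$. Define $\tilde{A}_n(p,q)=A_n(p,q)$ if $n$ is odd and $\tilde{A}_n(p,q)=(1+q)A_n(p,q)$ if $n$ is even. The identities are identities of rational functions in indeterminates $p,q$. -}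

module Defs where

open import Data.Nat as ℕ using (ℕ; zero; suc; _<ᵇ_)
open import Data.Nat.Properties as ℕP using ()
open import Data.Bool using (Bool; true; false; if_then_else_)
open import Data.List using (List; []; _∷_; map; concatMap; filter; foldr; upTo)
open import Data.Rational using (ℚ; 0ℚ; 1ℚ; _+_; _*_)
import Data.List.Relation.Unary.Unique.DecPropositional as UniqueDec

_^_ : ℚ → ℕ → ℚ
x ^ zero  = 1ℚ
x ^ suc k = x * (x ^ k)

words : ℕ → ℕ → List (List ℕ)
words n zero    = [] ∷ []
words n (suc k) = concatMap (λ a → map (a ∷_) (words n k)) (map suc (upTo n))

-- 𝔖ₙ : the permutations of [n] = {1,…,n}, in one-line notation a₁⋯aₙ,
-- i.e. the words of length n over [n] with pairwise distinct letters
Perms : ℕ → List (List ℕ)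
Perms n = filter (UniqueDec.unique? ℕP._≟_) (words n n)

isOdd : ℕ → Bool
isOdd zero    = false
isOdd (suc i) = Data.Bool.not (isOdd i)
  where import Data.Bool

odesFrom : ℕ → List ℕ → ℕ
odesFrom i []           = 0
odesFrom i (a ∷ [])     = 0
odesFrom i (a ∷ b ∷ w)  =
  (if (b <ᵇ a) Data.Bool.∧ isOdd i then 1 else 0) ℕ.+ odesFrom (suc i) (b ∷ w)
  where import Data.Bool

edesFrom : ℕ → List ℕ → ℕ
edesFrom i []           = 0
edesFrom i (a ∷ [])     = 0
edesFrom i (a ∷ b ∷ w)  =
  (if (b <ᵇ a) Data.Bool.∧ Data.Bool.not (isOdd i) then 1 else 0) ℕ.+ edesFrom (suc i) (b ∷ w)
  where import Data.Bool

-- positions are 1-based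
odes edes : List ℕ → ℕ
odes = odesFrom 1
edes = edesFrom 1

A : ℕ → ℚ → ℚ → ℚ
A n p q = foldr (λ π s → (p ^ odes π) * (q ^ edes π) + s) 0ℚ (Perms n)

Ã : ℕ → ℚ → ℚ → ℚ
Ã n p q = if isOdd n then A n p q else (1ℚ + q) * A n p q

{-# OPTIONS --safe #-}
-- Group the permutations by the rank of their first letter among the letters following it.
-- The refined generating functions Aʳ obey a linear recursion in which each letter applies a
-- transfer operator; it splits as ½(1+w)·(total) + ½(1−w)·Δ, where Δ exchanges palindromic and
-- antipalindromic functions of the rank.  Two consecutive letters with descent weights (p, q)
-- act on these two parts exactly as the weights (t, 0), t = (p+q)/(1+pq), do, up to the scalars
-- 1 ± q and 1 + pq, because (1+pq)(1 ± t) = (1 ± p)(1 ± q).  Summing over the rank kills the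
-- antipalindromic parts, which leaves the identity.
module Submission where

open import Defs
open import Data.Nat using (ℕ; _≥_; _/_)
open import Data.Rational using (ℚ; 0ℚ; 1ℚ; _+_; _*_; _÷_; ≢-nonZero)
open import Relation.Binary.PropositionalEquality using (_≡_; _≢_)

open import Data.Bool using (Bool; true; false; if_then_else_; not; _∧_)
open import Data.Bool.Properties using (∧-assoc; ∧-zeroʳ; ∧-identityʳ; not-involutive; ∧-commutativeMonoid)
open import Algebra.Bundles using (CommutativeMonoid)
open import Algebra.Properties.CommutativeSemigroup (CommutativeMonoid.commutativeSemigroup ∧-commutativeMonoid)
  using () renaming (interchange to ∧-interchange)
open import Data.List using (List; []; _∷_; map; concatMap; filter; foldr; upTo; length; _++_)
open import Data.Bool.ListAction using (all)
open import Data.List.Properties using (foldr-map; length-map; length-upTo)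
open import Data.List.Membership.Propositional using (_∈_)
open import Data.List.Relation.Unary.Any using (here; there)
import Data.List.Relation.Unary.All as All
open import Data.List.Relation.Unary.All using (All; all?)
open import Data.List.Relation.Unary.AllPairs using (AllPairs; []; _∷_)
import Data.List.Relation.Unary.AllPairs.Properties as AllPairs
open import Data.Nat as ℕ using (zero; suc; _<ᵇ_; _≡ᵇ_; _<_; _≤_; z≤n; s≤s)
open import Data.Nat.DivMod using (m/n≡1+[m∸n]/n)
import Data.Nat.Properties as ℕₚ
open import Data.List.Relation.Unary.Unique.DecPropositional ℕₚ._≟_ using (unique?)
open import Data.Rational using (NonZero; -_; _-_; ½; 1/_)
import Data.Rational.Properties as ℚₚ
open import Function using (_∘_; id)
open import Level using (0ℓ)
open import Relation.Nullary.Decidable using (does; yes; no; ¬?; dec-true; dec-false; dec⇒maybe)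
open import Relation.Unary using (Pred; Decidable)
open import Relation.Binary.PropositionalEquality
  using (refl; sym; trans; cong; cong₂; subst; subst₂; module ≡-Reasoning)
open import Tactic.RingSolver using (solve-∀)
open import Tactic.RingSolver.Core.AlmostCommutativeRing
  using (AlmostCommutativeRing; fromCommutativeRing)

open ≡-Reasoning

ℚ-ring : AlmostCommutativeRing _ _
ℚ-ring = fromCommutativeRing ℚₚ.+-*-commutativeRing (λ x → dec⇒maybe (0ℚ ℚₚ.≟ x))

∑ : ℕ → (ℕ → ℚ) → ℚ
∑ zero    f = 0ℚ
∑ (suc k) f = ∑ k f + f k

infix 5 ∑
syntax ∑ k (λ j → e) = ∑[ j < k ] e

∑-cong : ∀ k {f g : ℕ → ℚ} → (∀ j → f j ≡ g j) → ∑ k f ≡ ∑ k g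
∑-cong zero    e = refl
∑-cong (suc k) e = cong₂ _+_ (∑-cong k e) (e k)

-- A record rather than a Π-type so that its six indices can be inferred: ℚ's _*_ is not injective.
infix 4 _⊙_≈_⊙_⊕_⊙_
record _⊙_≈_⊙_⊕_⊙_ (d : ℚ) (f : ℕ → ℚ) (α : ℚ) (g : ℕ → ℚ) (β : ℚ) (h : ℕ → ℚ) : Set where
  constructor pointwise
  field at : ∀ j → d * f j ≡ α * g j + β * h j

∑-linear : ∀ k {d α β f g h} → d ⊙ f ≈ α ⊙ g ⊕ β ⊙ h → d * ∑ k f ≡ α * ∑ k g + β * ∑ k h
∑-linear zero    {d} {α} {β} _ = zeros d α β
  where
  zeros : ∀ d α β → d * 0ℚ ≡ α * 0ℚ + β * 0ℚ
  zeros = solve-∀ ℚ-ring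
∑-linear (suc k) {d} {α} {β} {f} {g} {h} rel@(pointwise e) = begin
  d * (∑ k f + f k)                              ≡⟨ ℚₚ.*-distribˡ-+ d (∑ k f) (f k) ⟩
  d * ∑ k f + d * f k                            ≡⟨ cong₂ _+_ (∑-linear k rel) (e k) ⟩
  (α * ∑ k g + β * ∑ k h) + (α * g k + β * h k)  ≡⟨ regroup α β (∑ k g) (∑ k h) (g k) (h k) ⟩
  α * (∑ k g + g k) + β * (∑ k h + h k)          ∎
  where
  regroup : ∀ α β G H x y → (α * G + β * H) + (α * x + β * y) ≡ α * (G + x) + β * (H + y)
  regroup = solve-∀ ℚ-ring

∑-neg : ∀ k (f : ℕ → ℚ) → ∑[ j < k ] (- f j) ≡ - ∑ k f
∑-neg zero    f = refl
∑-neg (suc k) f = trans (cong (_+ - f k) (∑-neg k f)) (sym (ℚₚ.neg-distrib-+ (∑ k f) (f k)))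

∑-suc : ∀ k (f : ℕ → ℚ) → ∑ (suc k) f ≡ f 0 + (∑[ j < k ] f (suc j))
∑-suc zero    f = trans (ℚₚ.+-identityˡ (f 0)) (sym (ℚₚ.+-identityʳ (f 0)))
∑-suc (suc k) f = trans (cong (_+ f (suc k)) (∑-suc k f)) (ℚₚ.+-assoc (f 0) _ _)

∑-reverse : ∀ K (f g : ℕ → ℚ) → (∀ j j′ → j ℕ.+ j′ ≡ K → f j ≡ g j′) → ∑ (suc K) f ≡ ∑ (suc K) g
∑-reverse zero    f g e = cong (0ℚ +_) (e 0 0 refl)
∑-reverse (suc K) f g e = begin
  ∑ (suc (suc K)) f
    ≡⟨ ∑-suc (suc K) f ⟩
  f 0 + (∑[ j < suc K ] f (suc j))
    ≡⟨ cong₂ _+_ (e 0 (suc K) refl) (∑-reverse K (f ∘ suc) g (λ j j′ → e (suc j) j′ ∘ cong suc)) ⟩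
  g (suc K) + ∑ (suc K) g
    ≡⟨ ℚₚ.+-comm (g (suc K)) (∑ (suc K) g) ⟩
  ∑ (suc (suc K)) g ∎

-- Palindromic and antipalindromic parts

Palindromic AntiPalindromic : ℕ → (ℕ → ℚ) → Set
Palindromic     K f = ∀ r s → r ℕ.+ s ≡ K → f r ≡ f s
AntiPalindromic K f = ∀ r s → r ℕ.+ s ≡ K → f r ≡ - f s

x≡-x⇒x≡0 : ∀ {x} → x ≡ - x → x ≡ 0ℚ
x≡-x⇒x≡0 {x} x≡-x = begin
  x              ≡⟨ halve x ⟩
  ½ * (x + x)    ≡⟨ cong (λ y → ½ * (x + y)) x≡-x ⟩
  ½ * (x + - x)  ≡⟨ cancel x ⟩
  0ℚ             ∎
  where
  halve : ∀ x → x ≡ ½ * (x + x)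
  halve = solve-∀ ℚ-ring
  cancel : ∀ x → ½ * (x + - x) ≡ 0ℚ
  cancel = solve-∀ ℚ-ring

∑-antipalindromic : ∀ K {a} → AntiPalindromic K a → ∑ (suc K) a ≡ 0ℚ
∑-antipalindromic K {a} anti =
  x≡-x⇒x≡0 (trans (∑-reverse K a (λ j → - a j) anti) (∑-neg (suc K) a))

sign : Bool → ℚ
sign b = if b then - 1ℚ else 1ℚ

weight : ℚ → Bool → ℚ
weight w b = if b then w else 1ℚ

Δ : ℕ → (ℕ → ℚ) → ℕ → ℚ
Δ k f r = ∑[ j < k ] sign (j <ᵇ r) * f j

transfer : ℚ → ℕ → (ℕ → ℚ) → ℕ → ℚ
transfer w k f r = ∑[ j < k ] weight w (j <ᵇ r) * f j

<ᵇ-true : ∀ {m n} → m < n → (m <ᵇ n) ≡ true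
<ᵇ-true {m} {n} = dec-true (m ℕₚ.<? n)

<ᵇ-false : ∀ {m n} → n ≤ m → (m <ᵇ n) ≡ false
<ᵇ-false {m} {n} n≤m = dec-false (m ℕₚ.<? n) (ℕₚ.≤⇒≯ n≤m)

<ᵇ-complement : ∀ j j′ r s → r ℕ.+ s ≡ suc (j ℕ.+ j′) → (j <ᵇ r) ≡ not (j′ <ᵇ s)
<ᵇ-complement j       j′ zero    s e = sym (cong not (<ᵇ-true (subst (j′ <_) (sym e) (s≤s (ℕₚ.m≤n+m j′ j)))))
<ᵇ-complement zero    j′ (suc r) s e = sym (cong not (<ᵇ-false (subst (s ≤_) (ℕₚ.suc-injective e) (ℕₚ.m≤n+m s r))))
<ᵇ-complement (suc j) j′ (suc r) s e = <ᵇ-complement j j′ r s (ℕₚ.suc-injective e)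

sign-not : ∀ b → sign (not b) ≡ - sign b
sign-not true  = refl
sign-not false = refl

Δ-antipalindromic : ∀ K {f} → Palindromic K f → AntiPalindromic (suc K) (Δ (suc K) f)
Δ-antipalindromic K {f} pal r s e =
  trans (∑-reverse K _ (λ j′ → - (sign (j′ <ᵇ s) * f j′)) reflect) (∑-neg (suc K) _)
  where
  reflect : ∀ j j′ → j ℕ.+ j′ ≡ K → sign (j <ᵇ r) * f j ≡ - (sign (j′ <ᵇ s) * f j′)
  reflect j j′ e′
    rewrite <ᵇ-complement j j′ r s (trans e (cong suc (sym e′))) | sign-not (j′ <ᵇ s) | pal j j′ e′
    = sym (ℚₚ.neg-distribˡ-* (sign (j′ <ᵇ s)) (f j′))

Δ-palindromic : ∀ K {f} → AntiPalindromic K f → Palindromic (suc K) (Δ (suc K) f)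
Δ-palindromic K {f} anti r s e = ∑-reverse K _ _ reflect
  where
  neg*neg : ∀ x y → - x * - y ≡ x * y
  neg*neg = solve-∀ ℚ-ring
  reflect : ∀ j j′ → j ℕ.+ j′ ≡ K → sign (j <ᵇ r) * f j ≡ sign (j′ <ᵇ s) * f j′
  reflect j j′ e′
    rewrite <ᵇ-complement j j′ r s (trans e (cong suc (sym e′))) | sign-not (j′ <ᵇ s) | anti j j′ e′
    = neg*neg (sign (j′ <ᵇ s)) (f j′)

transfer-via-Δ : ∀ w k f r → transfer w k f r ≡ ½ * (1ℚ + w) * ∑ k f + ½ * (1ℚ - w) * Δ k f r
transfer-via-Δ w k f r = trans (sym (ℚₚ.*-identityˡ _)) (∑-linear k decomposition)
  where
  descent : ∀ w x → 1ℚ * (w * x) ≡ ½ * (1ℚ + w) * x + ½ * (1ℚ - w) * (- 1ℚ * x)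
  descent = solve-∀ ℚ-ring
  ascent : ∀ w x → 1ℚ * (1ℚ * x) ≡ ½ * (1ℚ + w) * x + ½ * (1ℚ - w) * (1ℚ * x)
  ascent = solve-∀ ℚ-ring
  decomposition : 1ℚ ⊙ (λ j → weight w (j <ᵇ r) * f j)
                  ≈ ½ * (1ℚ + w) ⊙ f ⊕ ½ * (1ℚ - w) ⊙ (λ j → sign (j <ᵇ r) * f j)
  decomposition = pointwise λ j → split (j <ᵇ r) (f j)
    where
    split : ∀ b x → 1ℚ * (weight w b * x) ≡ ½ * (1ℚ + w) * x + ½ * (1ℚ - w) * (sign b * x)
    split true  = descent w
    split false = ascent w

∑-split : ∀ K {d α β f s a} → AntiPalindromic K a → d ⊙ f ≈ α ⊙ s ⊕ β ⊙ a →
          d * ∑ (suc K) f ≡ α * ∑ (suc K) s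
∑-split K {d} {α} {β} {f} {s} {a} anti split = begin
  d * ∑ (suc K) f                        ≡⟨ ∑-linear (suc K) split ⟩
  α * ∑ (suc K) s + β * ∑ (suc K) a      ≡⟨ cong (λ z → α * ∑ (suc K) s + β * z) (∑-antipalindromic K anti) ⟩
  α * ∑ (suc K) s + β * 0ℚ               ≡⟨ drop α β (∑ (suc K) s) ⟩
  α * ∑ (suc K) s                        ∎
  where
  drop : ∀ α β x → α * x + β * 0ℚ ≡ α * x
  drop = solve-∀ ℚ-ring

Δ-split : ∀ k {d α β f s a} → d ⊙ f ≈ α ⊙ s ⊕ β ⊙ a → ∀ r → d * Δ k f r ≡ α * Δ k s r + β * Δ k a r
Δ-split k {d} {α} {β} {f} {s} {a} (pointwise split) r = ∑-linear k signed
  where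
  move : ∀ σ d x → d * (σ * x) ≡ σ * (d * x)
  move = solve-∀ ℚ-ring
  distribute : ∀ σ α β y z → σ * (α * y + β * z) ≡ α * (σ * y) + β * (σ * z)
  distribute = solve-∀ ℚ-ring
  σ : ℕ → ℚ
  σ j = sign (j <ᵇ r)
  signed : d ⊙ (λ j → σ j * f j) ≈ α ⊙ (λ j → σ j * s j) ⊕ β ⊙ (λ j → σ j * a j)
  signed = pointwise λ j → trans (move (σ j) d (f j)) (trans (cong (σ j *_) (split j)) (distribute (σ j) α β (s j) (a j)))

transfer-split : ∀ K {d α β f s a} → AntiPalindromic K a → d ⊙ f ≈ α ⊙ s ⊕ β ⊙ a → ∀ y r →
                 d * transfer y (suc K) f r
                   ≡ ½ * (1ℚ + y) * (α * ∑ (suc K) s)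
                     + ½ * (1ℚ - y) * (α * Δ (suc K) s r + β * Δ (suc K) a r)
transfer-split K {d} {f = f} anti split y r = begin
  d * transfer y (suc K) f r
    ≡⟨ cong (d *_) (transfer-via-Δ y (suc K) f r) ⟩
  d * (½ * (1ℚ + y) * ∑ (suc K) f + ½ * (1ℚ - y) * Δ (suc K) f r)
    ≡⟨ distribute d (½ * (1ℚ + y)) (½ * (1ℚ - y)) (∑ (suc K) f) (Δ (suc K) f r) ⟩
  ½ * (1ℚ + y) * (d * ∑ (suc K) f) + ½ * (1ℚ - y) * (d * Δ (suc K) f r)
    ≡⟨ cong₂ (λ u v → ½ * (1ℚ + y) * u + ½ * (1ℚ - y) * v) (∑-split K anti split) (Δ-split (suc K) split r) ⟩
  _ ∎
  where
  distribute : ∀ d α β x z → d * (α * x + β * z) ≡ α * (d * x) + β * (d * z)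
  distribute = solve-∀ ℚ-ring

-- Coupling the weights (p, q) with (t, 0)

record Coupling (K : ℕ) (d c : ℚ) (v w : ℕ → ℚ) (α β γ δ : ℚ) : Set where
  field
    pal anti             : ℕ → ℚ
    pal-palindromic      : Palindromic K pal
    anti-antipalindromic : AntiPalindromic K anti
    v-split              : d ⊙ v ≈ α ⊙ pal ⊕ β ⊙ anti
    w-split              : c ⊙ w ≈ γ ⊙ pal ⊕ δ ⊙ anti

Coupling-∑ : ∀ {K d c v w α β δ} → Coupling K d c v w α β α δ → d * ∑ (suc K) v ≡ c * ∑ (suc K) w
Coupling-∑ {K} C = trans (∑-split K anti-antipalindromic v-split) (sym (∑-split K anti-antipalindromic w-split))
  where open Coupling C

constant-coupling : ∀ {K} d c β δ → Coupling K d c (λ _ → 1ℚ) (λ _ → 1ℚ) d β c δ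
constant-coupling d c β δ = record
  { pal                  = λ _ → 1ℚ
  ; anti                 = λ _ → 0ℚ
  ; pal-palindromic      = λ _ _ _ → refl
  ; anti-antipalindromic = λ _ _ _ → refl
  ; v-split              = pointwise λ _ → constant d β
  ; w-split              = pointwise λ _ → constant c δ
  }
  where
  constant : ∀ d β → d * 1ℚ ≡ d * 1ℚ + β * 0ℚ
  constant = solve-∀ ℚ-ring

[1+pq][1±t]≡[1±p][1±q] : ∀ p q t → (1ℚ + p * q) * t ≡ p + q → ∀ x y →
  (1ℚ + p * q) * (½ * (1ℚ + t) * x + ½ * (1ℚ - t) * y)
    ≡ ½ * ((1ℚ + p) * (1ℚ + q)) * x + ½ * ((1ℚ - p) * (1ℚ - q)) * y
[1+pq][1±t]≡[1±p][1±q] p q t [1+pq]t≡p+q x y = begin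
  (1ℚ + p * q) * (½ * (1ℚ + t) * x + ½ * (1ℚ - t) * y)
    ≡⟨ expand (1ℚ + p * q) t x y ⟩
  ½ * ((1ℚ + p * q) + (1ℚ + p * q) * t) * x + ½ * ((1ℚ + p * q) - (1ℚ + p * q) * t) * y
    ≡⟨ cong (λ z → ½ * ((1ℚ + p * q) + z) * x + ½ * ((1ℚ + p * q) - z) * y) [1+pq]t≡p+q ⟩
  ½ * ((1ℚ + p * q) + (p + q)) * x + ½ * ((1ℚ + p * q) - (p + q)) * y
    ≡⟨ factor p q x y ⟩
  ½ * ((1ℚ + p) * (1ℚ + q)) * x + ½ * ((1ℚ - p) * (1ℚ - q)) * y ∎
  where
  expand : ∀ P t x y → P * (½ * (1ℚ + t) * x + ½ * (1ℚ - t) * y)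
                       ≡ ½ * (P + P * t) * x + ½ * (P - P * t) * y
  expand = solve-∀ ℚ-ring
  factor : ∀ p q x y → ½ * ((1ℚ + p * q) + (p + q)) * x + ½ * ((1ℚ + p * q) - (p + q)) * y
                       ≡ ½ * ((1ℚ + p) * (1ℚ + q)) * x + ½ * ((1ℚ - p) * (1ℚ - q)) * y
  factor = solve-∀ ℚ-ring

module _ (q : ℚ) where

  OddCoupling EvenCoupling : ℕ → ℚ → ℚ → (ℕ → ℚ) → (ℕ → ℚ) → Set
  OddCoupling  K d c v w = Coupling K d c v w 1ℚ (1ℚ + q) 1ℚ (1ℚ - q)
  EvenCoupling K d c v w = Coupling K d c v w (1ℚ + q) (1ℚ - q) 1ℚ 1ℚ

  odd→even : ∀ {K d c v w} → OddCoupling K d c v w →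
             EvenCoupling (suc K) d c (transfer q (suc K) v) (transfer 0ℚ (suc K) w)
  odd→even {K} {d} {c} {v} {w} C = record
    { pal                  = pal′
    ; anti                 = anti′
    ; pal-palindromic      = λ r r′ e →
        cong (λ z → ½ * (S + (1ℚ - q) * z)) (Δ-palindromic K anti-antipalindromic r r′ e)
    ; anti-antipalindromic = λ r r′ e →
        trans (cong (½ *_) (Δ-antipalindromic K pal-palindromic r r′ e)) (sym (ℚₚ.neg-distribʳ-* ½ (Z r′)))
    ; v-split = pointwise λ r →
        trans (transfer-split K anti-antipalindromic v-split q r) (regroup-v q S (Z r) (Y r))
    ; w-split = pointwise λ r →
        trans (transfer-split K anti-antipalindromic w-split 0ℚ r) (regroup-w q S (Z r) (Y r))
    }
    where
    open Coupling C
    S : ℚ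
    S = ∑ (suc K) pal
    Z Y : ℕ → ℚ
    Z = Δ (suc K) pal
    Y = Δ (suc K) anti
    pal′ anti′ : ℕ → ℚ
    pal′  r = ½ * (S + (1ℚ - q) * Y r)
    anti′ r = ½ * Z r
    regroup-v : ∀ q S Z Y → ½ * (1ℚ + q) * (1ℚ * S) + ½ * (1ℚ - q) * (1ℚ * Z + (1ℚ + q) * Y)
                            ≡ (1ℚ + q) * (½ * (S + (1ℚ - q) * Y)) + (1ℚ - q) * (½ * Z)
    regroup-v = solve-∀ ℚ-ring
    regroup-w : ∀ q S Z Y → ½ * (1ℚ + 0ℚ) * (1ℚ * S) + ½ * (1ℚ - 0ℚ) * (1ℚ * Z + (1ℚ - q) * Y)
                            ≡ 1ℚ * (½ * (S + (1ℚ - q) * Y)) + 1ℚ * (½ * Z)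
    regroup-w = solve-∀ ℚ-ring

  even→odd : ∀ p t → (1ℚ + p * q) * t ≡ p + q → ∀ {K d c v w} → EvenCoupling K d c v w →
             OddCoupling (suc K) d ((1ℚ + p * q) * c) (transfer p (suc K) v) (transfer t (suc K) w)
  even→odd p t [1+pq]t≡p+q {K} {d} {c} {v} {w} C = record
    { pal                  = pal′
    ; anti                 = anti′
    ; pal-palindromic      = λ r r′ e →
        cong (λ z → ½ * ((1ℚ + p) * (1ℚ + q) * S + (1ℚ - p) * (1ℚ - q) * z))
             (Δ-palindromic K anti-antipalindromic r r′ e)
    ; anti-antipalindromic = λ r r′ e →
        trans (cong (λ z → ½ * ((1ℚ - p) * z)) (Δ-antipalindromic K pal-palindromic r r′ e)) (negate p (Z r′))
    ; v-split = pointwise λ r →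
        trans (transfer-split K anti-antipalindromic v-split p r) (regroup-v p q S (Z r) (Y r))
    ; w-split = pointwise λ r → begin
        (1ℚ + p * q) * c * transfer t (suc K) w r
          ≡⟨ ℚₚ.*-assoc (1ℚ + p * q) c _ ⟩
        (1ℚ + p * q) * (c * transfer t (suc K) w r)
          ≡⟨ cong ((1ℚ + p * q) *_) (transfer-split K anti-antipalindromic w-split t r) ⟩
        (1ℚ + p * q) * (½ * (1ℚ + t) * (1ℚ * S) + ½ * (1ℚ - t) * (1ℚ * Z r + 1ℚ * Y r))
          ≡⟨ [1+pq][1±t]≡[1±p][1±q] p q t [1+pq]t≡p+q (1ℚ * S) (1ℚ * Z r + 1ℚ * Y r) ⟩
        ½ * ((1ℚ + p) * (1ℚ + q)) * (1ℚ * S) + ½ * ((1ℚ - p) * (1ℚ - q)) * (1ℚ * Z r + 1ℚ * Y r)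
          ≡⟨ regroup-w p q S (Z r) (Y r) ⟩
        1ℚ * pal′ r + (1ℚ - q) * anti′ r ∎
    }
    where
    open Coupling C
    S : ℚ
    S = ∑ (suc K) pal
    Z Y : ℕ → ℚ
    Z = Δ (suc K) pal
    Y = Δ (suc K) anti
    pal′ anti′ : ℕ → ℚ
    pal′  r = ½ * ((1ℚ + p) * (1ℚ + q) * S + (1ℚ - p) * (1ℚ - q) * Y r)
    anti′ r = ½ * ((1ℚ - p) * Z r)
    negate : ∀ p x → ½ * ((1ℚ - p) * - x) ≡ - (½ * ((1ℚ - p) * x))
    negate = solve-∀ ℚ-ring
    regroup-v : ∀ p q S Z Y → ½ * (1ℚ + p) * ((1ℚ + q) * S) + ½ * (1ℚ - p) * ((1ℚ + q) * Z + (1ℚ - q) * Y)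
                ≡ 1ℚ * (½ * ((1ℚ + p) * (1ℚ + q) * S + (1ℚ - p) * (1ℚ - q) * Y)) + (1ℚ + q) * (½ * ((1ℚ - p) * Z))
    regroup-v = solve-∀ ℚ-ring
    regroup-w : ∀ p q S Z Y → ½ * ((1ℚ + p) * (1ℚ + q)) * (1ℚ * S) + ½ * ((1ℚ - p) * (1ℚ - q)) * (1ℚ * Z + 1ℚ * Y)
                ≡ 1ℚ * (½ * ((1ℚ + p) * (1ℚ + q) * S + (1ℚ - p) * (1ℚ - q) * Y)) + (1ℚ - q) * (½ * ((1ℚ - p) * Z))
    regroup-w = solve-∀ ℚ-ring

-- Permutations counted by the rank of their first letter

-- Aʳ x y k r : descent generating function of the arrangements of k letters written after a
-- letter exceeding exactly r of them, descents weighted alternately x, y starting with that letter.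
Aʳ : ℚ → ℚ → ℕ → ℕ → ℚ
Aʳ x y zero    r = 1ℚ
Aʳ x y (suc k) r = transfer x (suc k) (Aʳ y x k) r

∑ˡ : {A : Set} → (A → ℚ) → List A → ℚ
∑ˡ f = foldr (λ a s → f a + s) 0ℚ

∑ˡ-cong-∈ : ∀ {A : Set} {f g : A → ℚ} l → (∀ {a} → a ∈ l → f a ≡ g a) → ∑ˡ f l ≡ ∑ˡ g l
∑ˡ-cong-∈ []      e = refl
∑ˡ-cong-∈ (a ∷ l) e = cong₂ _+_ (e (here refl)) (∑ˡ-cong-∈ l (e ∘ there))

∑ˡ-map : ∀ {A B : Set} (f : B → ℚ) (g : A → B) l → ∑ˡ f (map g l) ≡ ∑ˡ (f ∘ g) l
∑ˡ-map f g = foldr-map _ g 0ℚ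

∑ˡ-++ : ∀ {A : Set} (f : A → ℚ) l m → ∑ˡ f (l ++ m) ≡ ∑ˡ f l + ∑ˡ f m
∑ˡ-++ f []      m = sym (ℚₚ.+-identityˡ _)
∑ˡ-++ f (a ∷ l) m = trans (cong (f a +_) (∑ˡ-++ f l m)) (sym (ℚₚ.+-assoc (f a) _ _))

∑ˡ-concatMap : ∀ {A B : Set} (f : B → ℚ) (g : A → List B) l → ∑ˡ f (concatMap g l) ≡ ∑ˡ (λ a → ∑ˡ f (g a)) l
∑ˡ-concatMap f g []      = refl
∑ˡ-concatMap f g (a ∷ l) = trans (∑ˡ-++ f (g a) (concatMap g l)) (cong (∑ˡ f (g a) +_) (∑ˡ-concatMap f g l))

∑ˡ-*ˡ : ∀ {A : Set} c (f : A → ℚ) l → ∑ˡ (λ a → c * f a) l ≡ c * ∑ˡ f l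
∑ˡ-*ˡ c f []      = sym (ℚₚ.*-zeroʳ c)
∑ˡ-*ˡ c f (a ∷ l) = trans (cong (c * f a +_) (∑ˡ-*ˡ c f l)) (sym (ℚₚ.*-distribˡ-+ c (f a) _))

∑ˡ-zero : ∀ {A : Set} (l : List A) → ∑ˡ (λ _ → 0ℚ) l ≡ 0ℚ
∑ˡ-zero []      = refl
∑ˡ-zero (a ∷ l) = trans (ℚₚ.+-identityˡ _) (∑ˡ-zero l)

∑ˡ-filter : ∀ {A : Set} {P : Pred A 0ℓ} (P? : Decidable P) (f : A → ℚ) l →
            ∑ˡ f (filter P? l) ≡ ∑ˡ (λ a → if does (P? a) then f a else 0ℚ) l
∑ˡ-filter P? f []      = refl
∑ˡ-filter P? f (a ∷ l) with does (P? a)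
... | true  = cong (f a +_) (∑ˡ-filter P? f l)
... | false = trans (∑ˡ-filter P? f l) (sym (ℚₚ.+-identityˡ _))

if-*ˡ : ∀ b {c x y : ℚ} → x ≡ c * y → (if b then x else 0ℚ) ≡ c * (if b then y else 0ℚ)
if-*ˡ true  e = e
if-*ˡ false {c} e = sym (ℚₚ.*-zeroʳ c)

count : (ℕ → Bool) → List ℕ → ℕ
count P []      = 0
count P (b ∷ l) = if P b then suc (count P l) else count P l

count-∷-true : ∀ P {b} l → P b ≡ true → count P (b ∷ l) ≡ suc (count P l)
count-∷-true P l = cong (λ c → if c then suc (count P l) else count P l)

count-∷-false : ∀ P {b} l → P b ≡ false → count P (b ∷ l) ≡ count P l
count-∷-false P l = cong (λ c → if c then suc (count P l) else count P l)

count-cong-∈ : ∀ {P R} l → (∀ {b} → b ∈ l → P b ≡ R b) → count P l ≡ count R l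
count-cong-∈ []      e = refl
count-cong-∈ (b ∷ l) e = cong₂ (λ c m → if c then suc m else m) (e (here refl)) (count-cong-∈ l (e ∘ there))

count-true : ∀ l → count (λ _ → true) l ≡ length l
count-true []      = refl
count-true (b ∷ l) = cong suc (count-true l)

rank : (ℕ → Bool) → List ℕ → ℕ → ℕ
rank P l x = count (λ b → P b ∧ (b <ᵇ x)) l

rank-below : ∀ P {x} l → All (x ≤_) l → rank P l x ≡ 0
rank-below P []      All.[]           = refl
rank-below P (b ∷ l) (x≤b All.∷ x≤l) =
  trans (count-∷-false _ l (trans (cong (P b ∧_) (<ᵇ-false x≤b)) (∧-zeroʳ (P b)))) (rank-below P l x≤l)

-- Along an increasing list the letters satisfying P have ranks 0, 1, …, and a < x iff rank a < rank x.
∑ˡ-byRank : ∀ {l} → AllPairs _<_ l → ∀ P w x (f : ℕ → ℚ) →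
            ∑ˡ (λ a → if P a then weight w (a <ᵇ x) * f (rank P l a) else 0ℚ) l
              ≡ transfer w (count P l) f (rank P l x)
∑ˡ-byRank []                 P w x f = refl
∑ˡ-byRank {u ∷ l} (u<l ∷ l↑) P w x f with P u
... | false = trans (ℚₚ.+-identityˡ _) (∑ˡ-byRank l↑ P w x f)
... | true  = begin
  weight w (u <ᵇ x) * f (rank′ u) + ∑ˡ (λ a → if P a then weight w (a <ᵇ x) * f (rank′ a) else 0ℚ) l
    ≡⟨ cong₂ _+_ (cong (λ r → weight w (u <ᵇ x) * f r) rank′-u) (∑ˡ-cong-∈ l rank′-above) ⟩
  weight w (u <ᵇ x) * f 0 + ∑ˡ (λ a → if P a then weight w (a <ᵇ x) * f (suc (rank P l a)) else 0ℚ) l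
    ≡⟨ cong (weight w (u <ᵇ x) * f 0 +_) (∑ˡ-byRank l↑ P w x (f ∘ suc)) ⟩
  weight w (u <ᵇ x) * f 0 + transfer w (count P l) (f ∘ suc) (rank P l x)
    ≡⟨ head-vs-x ⟩
  transfer w (suc (count P l)) f (rank′ x) ∎
  where
  -- what rank P (u ∷ l) reduces to once P u is true
  rank′ : ℕ → ℕ
  rank′ y = if u <ᵇ y then suc (rank P l y) else rank P l y
  rank′-u : rank′ u ≡ 0
  rank′-u = trans (cong (λ c → if c then suc (rank P l u) else rank P l u) (<ᵇ-false (ℕₚ.≤-refl {u})))
                  (rank-below P l (All.map ℕₚ.<⇒≤ u<l))
  rank′-above : ∀ {a} → a ∈ l → (if P a then weight w (a <ᵇ x) * f (rank′ a) else 0ℚ)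
                               ≡ (if P a then weight w (a <ᵇ x) * f (suc (rank P l a)) else 0ℚ)
  rank′-above {a} a∈l = cong (λ c → if P a then weight w (a <ᵇ x) * f (if c then suc (rank P l a) else rank P l a) else 0ℚ)
                             (<ᵇ-true (All.lookup u<l a∈l))
  head-vs-x : weight w (u <ᵇ x) * f 0 + transfer w (count P l) (f ∘ suc) (rank P l x)
              ≡ transfer w (suc (count P l)) f (rank′ x)
  head-vs-x with u ℕₚ.<? x
  ... | yes u<x rewrite <ᵇ-true u<x = sym (∑-suc (count P l) _)
  ... | no  u≮x rewrite <ᵇ-false (ℕₚ.≮⇒≥ u≮x)
                      | rank-below P l (All.map (λ u<b → ℕₚ.≤-trans (ℕₚ.≮⇒≥ u≮x) (ℕₚ.<⇒≤ u<b)) u<l)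
                      = sym (∑-suc (count P l) _)

_∖_ : (ℕ → Bool) → ℕ → ℕ → Bool
(P ∖ a) b = P b ∧ not (a ≡ᵇ b)

≡ᵇ-refl : ∀ m → (m ≡ᵇ m) ≡ true
≡ᵇ-refl m = dec-true (m ℕₚ.≟ m) refl

≡ᵇ-false : ∀ {m n} → m ≢ n → (m ≡ᵇ n) ≡ false
≡ᵇ-false {m} {n} = dec-false (m ℕₚ.≟ n)

∖-other : ∀ P {a b} → a ≢ b → (P ∖ a) b ≡ P b
∖-other P {a} {b} a≢b = trans (cong (λ c → P b ∧ not c) (≡ᵇ-false a≢b)) (∧-identityʳ (P b))

count-∖ : ∀ {P a l} → AllPairs _<_ l → a ∈ l → P a ≡ true → suc (count (P ∖ a) l) ≡ count P l
count-∖ {P} {a} {a ∷ l} (a<l ∷ _) (here refl) Pa = begin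
  suc (count (P ∖ a) (a ∷ l))
    ≡⟨ cong suc (count-∷-false (P ∖ a) l (trans (cong (λ c → P a ∧ not c) (≡ᵇ-refl a)) (∧-zeroʳ (P a)))) ⟩
  suc (count (P ∖ a) l)
    ≡⟨ cong suc (count-cong-∈ l (λ b∈l → ∖-other P (ℕₚ.<⇒≢ (All.lookup a<l b∈l)))) ⟩
  suc (count P l)
    ≡⟨ count-∷-true P l Pa ⟨
  count P (a ∷ l) ∎
count-∖ {P} {a} {u ∷ l} (u<l ∷ l↑) (there a∈l) Pa =
  trans (cong (λ c → suc (if c then suc (count (P ∖ a) l) else count (P ∖ a) l))
              (∖-other P (ℕₚ.>⇒≢ (All.lookup u<l a∈l))))
        (step (P u) (count-∖ l↑ a∈l Pa))
  where
  step : ∀ b {m n} → suc m ≡ n → suc (if b then suc m else m) ≡ (if b then suc n else n)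
  step true  e = cong suc e
  step false e = e

rank-∖ : ∀ P a l → rank (P ∖ a) l a ≡ rank P l a
rank-∖ P a l = count-cong-∈ l (λ {b} _ → below b)
  where
  below : ∀ b → ((P b ∧ not (a ≡ᵇ b)) ∧ (b <ᵇ a)) ≡ (P b ∧ (b <ᵇ a))
  below b with b ℕₚ.<? a
  ... | yes b<a = cong (_∧ (b <ᵇ a)) (∖-other P (ℕₚ.>⇒≢ b<a))
  ... | no  b≮a rewrite <ᵇ-false (ℕₚ.≮⇒≥ b≮a) = trans (∧-zeroʳ _) (sym (∧-zeroʳ _))

distinctIn : (ℕ → Bool) → List ℕ → Bool
distinctIn P []      = true
distinctIn P (a ∷ w) = P a ∧ distinctIn (P ∖ a) w

does-all? : ∀ {P : Pred ℕ 0ℓ} (P? : Decidable P) w → does (all? P? w) ≡ all (does ∘ P?) w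
does-all? P? []      = refl
does-all? P? (b ∷ w) = cong (does (P? b) ∧_) (does-all? P? w)

all-∧ : ∀ (P R : ℕ → Bool) w → all (λ b → P b ∧ R b) w ≡ all P w ∧ all R w
all-∧ P R []      = refl
all-∧ P R (b ∷ w) = trans (cong ((P b ∧ R b) ∧_) (all-∧ P R w)) (∧-interchange (P b) (R b) (all P w) (all R w))

all-true : ∀ (w : List ℕ) → all (λ _ → true) w ≡ true
all-true []      = refl
all-true (b ∷ w) = all-true w

distinctIn≡all∧unique : ∀ P w → distinctIn P w ≡ all P w ∧ does (unique? w)
distinctIn≡all∧unique P []      = refl
distinctIn≡all∧unique P (a ∷ w) = begin
  P a ∧ distinctIn (P ∖ a) w
    ≡⟨ cong (P a ∧_) (distinctIn≡all∧unique (P ∖ a) w) ⟩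
  P a ∧ (all (P ∖ a) w ∧ does (unique? w))
    ≡⟨ cong (λ z → P a ∧ (z ∧ does (unique? w))) (all-∧ P (λ b → not (a ≡ᵇ b)) w) ⟩
  P a ∧ ((all P w ∧ all (λ b → not (a ≡ᵇ b)) w) ∧ does (unique? w))
    ≡⟨ cong (λ z → P a ∧ ((all P w ∧ z) ∧ does (unique? w))) (does-all? (λ b → ¬? (a ℕₚ.≟ b)) w) ⟨
  P a ∧ ((all P w ∧ N) ∧ does (unique? w))
    ≡⟨ cong (P a ∧_) (∧-assoc (all P w) N _) ⟩
  P a ∧ (all P w ∧ (N ∧ does (unique? w)))
    ≡⟨ ∧-assoc (P a) (all P w) _ ⟨
  (P a ∧ all P w) ∧ (N ∧ does (unique? w)) ∎
  where
  N : Bool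
  N = does (all? (λ b → ¬? (a ℕₚ.≟ b)) w)

wt : ℚ → ℚ → ℕ → ℚ
wt p q i = if isOdd i then p else q

wt-suc-suc : ∀ p q i → wt p q (suc (suc i)) ≡ wt p q i
wt-suc-suc p q i = cong (λ b → if b then p else q) (not-involutive (isOdd i))

W : ℚ → ℚ → ℕ → List ℕ → ℚ
W p q i w = (p ^ odesFrom i w) * (q ^ edesFrom i w)

W-∷∷ : ∀ p q i x a w → W p q i (x ∷ a ∷ w) ≡ weight (wt p q i) (a <ᵇ x) * W p q (suc i) (a ∷ w)
W-∷∷ p q i x a w = first-step (a <ᵇ x) (isOdd i) (odesFrom (suc i) (a ∷ w)) (edesFrom (suc i) (a ∷ w))
  where
  swap : ∀ x y z → x * (y * z) ≡ y * (x * z)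
  swap = solve-∀ ℚ-ring
  first-step : ∀ b o m n → (p ^ ((if b ∧ o then 1 else 0) ℕ.+ m)) * (q ^ ((if b ∧ not o then 1 else 0) ℕ.+ n))
                           ≡ weight (if o then p else q) b * ((p ^ m) * (q ^ n))
  first-step true  true  m n = ℚₚ.*-assoc p (p ^ m) (q ^ n)
  first-step true  false m n = swap (p ^ m) q (q ^ n)
  first-step false o     m n = sym (ℚₚ.*-identityˡ _)

W-0∷ : ∀ p q w → W p q 0 (0 ∷ w) ≡ W p q 1 w
W-0∷ p q []      = refl
W-0∷ p q (b ∷ w) = refl

module Arrangements (n : ℕ) (p q : ℚ) where

  letters : List ℕ
  letters = map suc (upTo n)

  letters-increasing : AllPairs _<_ letters
  letters-increasing = AllPairs.map⁺ (AllPairs.applyUpTo⁺₁ id n (λ i<j _ → s≤s i<j))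

  -- P marks the letters still available, x is the letter preceding w and i its position.
  arrangements-∑ : ∀ k P i x → count P letters ≡ k →
    ∑ˡ (λ w → if distinctIn P w then W p q i (x ∷ w) else 0ℚ) (words n k)
      ≡ Aʳ (wt p q i) (wt p q (suc i)) k (rank P letters x)
  arrangements-∑ zero    P i x _      = refl
  arrangements-∑ (suc k) P i x count≡ = begin
    ∑ˡ arrangement (concatMap (λ a → map (a ∷_) (words n k)) letters)
      ≡⟨ ∑ˡ-concatMap arrangement (λ a → map (a ∷_) (words n k)) letters ⟩
    ∑ˡ (λ a → ∑ˡ arrangement (map (a ∷_) (words n k))) letters
      ≡⟨ ∑ˡ-cong-∈ letters (λ {a} a∈ → trans (∑ˡ-map arrangement (a ∷_) (words n k)) (first-letter a∈)) ⟩
    ∑ˡ (λ a → if P a then weight wᵢ (a <ᵇ x) * rest (rank P letters a) else 0ℚ) letters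
      ≡⟨ ∑ˡ-byRank letters-increasing P wᵢ x rest ⟩
    transfer wᵢ (count P letters) rest (rank P letters x)
      ≡⟨ cong (λ m → transfer wᵢ m rest (rank P letters x)) count≡ ⟩
    Aʳ wᵢ (wt p q (suc i)) (suc k) (rank P letters x) ∎
    where
    wᵢ : ℚ
    wᵢ = wt p q i
    rest : ℕ → ℚ
    rest = Aʳ (wt p q (suc i)) wᵢ k
    arrangement : List ℕ → ℚ
    arrangement w = if distinctIn P w then W p q i (x ∷ w) else 0ℚ
    first-letter : ∀ {a} → a ∈ letters →
      ∑ˡ (arrangement ∘ (a ∷_)) (words n k) ≡ (if P a then weight wᵢ (a <ᵇ x) * rest (rank P letters a) else 0ℚ)
    first-letter {a} a∈ with P a in Pa
    ... | false = ∑ˡ-zero (words n k)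
    ... | true  = begin
      ∑ˡ (λ w → if distinctIn (P ∖ a) w then W p q i (x ∷ a ∷ w) else 0ℚ) (words n k)
        ≡⟨ ∑ˡ-cong-∈ (words n k) (λ {w} _ → if-*ˡ (distinctIn (P ∖ a) w) {c} (W-∷∷ p q i x a w)) ⟩
      ∑ˡ (λ w → c * (if distinctIn (P ∖ a) w then W p q (suc i) (a ∷ w) else 0ℚ)) (words n k)
        ≡⟨ ∑ˡ-*ˡ c _ (words n k) ⟩
      c * ∑ˡ (λ w → if distinctIn (P ∖ a) w then W p q (suc i) (a ∷ w) else 0ℚ) (words n k)
        ≡⟨ cong (c *_) (arrangements-∑ k (P ∖ a) (suc i) a count-∖≡) ⟩
      c * Aʳ (wt p q (suc i)) (wt p q (suc (suc i))) k (rank (P ∖ a) letters a)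
        ≡⟨ cong₂ (λ y r → c * Aʳ (wt p q (suc i)) y k r) (wt-suc-suc p q i) (rank-∖ P a letters) ⟩
      c * rest (rank P letters a) ∎
      where
      c : ℚ
      c = weight wᵢ (a <ᵇ x)
      count-∖≡ : count (P ∖ a) letters ≡ k
      count-∖≡ = ℕₚ.suc-injective (trans (count-∖ letters-increasing a∈ Pa) count≡)

  count-letters : count (λ _ → true) letters ≡ n
  count-letters = trans (count-true letters) (trans (length-map suc (upTo n)) (length-upTo n))

A≡∑Aʳ : ∀ k x y → A (suc k) x y ≡ ∑ (suc k) (Aʳ x y k)
A≡∑Aʳ k x y = begin
  A (suc k) x y
    ≡⟨ ∑ˡ-filter unique? (W x y 1) (words (suc k) (suc k)) ⟩
  ∑ˡ (λ w → if does (unique? w) then W x y 1 w else 0ℚ) (words (suc k) (suc k))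
    ≡⟨ ∑ˡ-cong-∈ (words (suc k) (suc k)) (λ {w} _ →
         cong₂ (λ b z → if b then z else 0ℚ) (sym (distinct w)) (sym (W-0∷ x y w))) ⟩
  ∑ˡ (λ w → if distinctIn (λ _ → true) w then W x y 0 (0 ∷ w) else 0ℚ) (words (suc k) (suc k))
    ≡⟨ arrangements-∑ (suc k) (λ _ → true) 0 0 count-letters ⟩
  Aʳ y x (suc k) (rank (λ _ → true) letters 0)
    ≡⟨ cong (Aʳ y x (suc k)) (rank-below (λ _ → true) letters (All.tabulate (λ _ → z≤n))) ⟩
  Aʳ y x (suc k) 0
    ≡⟨ ∑-cong (suc k) (λ j → ℚₚ.*-identityˡ (Aʳ x y k j)) ⟩
  ∑ (suc k) (Aʳ x y k) ∎
  where
  open Arrangements (suc k) x y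
  distinct : ∀ w → distinctIn (λ _ → true) w ≡ does (unique? w)
  distinct w = trans (distinctIn≡all∧unique (λ _ → true) w) (cong (_∧ does (unique? w)) (all-true w))

module Couplings (p q : ℚ) (1+pq≢0 : 1ℚ + p * q ≢ 0ℚ) where

  instance
    1+pq-nonZero : NonZero (1ℚ + p * q)
    1+pq-nonZero = ≢-nonZero 1+pq≢0

  t : ℚ
  t = (p + q) ÷ (1ℚ + p * q)

  [1+pq]t≡p+q : (1ℚ + p * q) * t ≡ p + q
  [1+pq]t≡p+q = begin
    (1ℚ + p * q) * ((p + q) * 1/ (1ℚ + p * q))  ≡⟨ swap (1ℚ + p * q) (p + q) (1/ (1ℚ + p * q)) ⟩
    (p + q) * ((1ℚ + p * q) * 1/ (1ℚ + p * q))  ≡⟨ cong ((p + q) *_) (ℚₚ.*-inverseʳ (1ℚ + p * q)) ⟩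
    (p + q) * 1ℚ                                ≡⟨ ℚₚ.*-identityʳ (p + q) ⟩
    p + q                                       ∎
    where
    swap : ∀ x y z → x * (y * z) ≡ y * (x * z)
    swap = solve-∀ ℚ-ring

  Ã-factor : ℕ → ℚ
  Ã-factor n = if isOdd n then 1ℚ else 1ℚ + q

  Ã≡Ã-factor*A : ∀ n → Ã n p q ≡ Ã-factor n * A n p q
  Ã≡Ã-factor*A n = by-parity (isOdd n)
    where
    by-parity : ∀ b → (if b then A n p q else (1ℚ + q) * A n p q) ≡ (if b then 1ℚ else 1ℚ + q) * A n p q
    by-parity true  = sym (ℚₚ.*-identityˡ (A n p q))
    by-parity false = refl

  -- Aʳ p q starts at an odd position, Aʳ q p at an even one.
  Aʳ-oddCoupling  : ∀ k → OddCoupling  q k (Ã-factor (suc k)) ((1ℚ + p * q) ^ (suc k / 2)) (Aʳ p q k) (Aʳ t 0ℚ k)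
  Aʳ-evenCoupling : ∀ k → EvenCoupling q k (Ã-factor k) ((1ℚ + p * q) ^ (k / 2)) (Aʳ q p k) (Aʳ 0ℚ t k)

  Aʳ-oddCoupling zero    = constant-coupling 1ℚ 1ℚ (1ℚ + q) (1ℚ - q)
  Aʳ-oddCoupling (suc k) =
    subst₂ (λ d c → OddCoupling q (suc k) d c (Aʳ p q (suc k)) (Aʳ t 0ℚ (suc k)))
           Ã-factor-suc-suc (cong ((1ℚ + p * q) ^_) (sym half-suc-suc))
           (even→odd q p t [1+pq]t≡p+q (Aʳ-evenCoupling k))
    where
    Ã-factor-suc-suc : Ã-factor k ≡ Ã-factor (suc (suc k))
    Ã-factor-suc-suc = cong (λ b → if b then 1ℚ else 1ℚ + q) (sym (not-involutive (isOdd k)))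
    half-suc-suc : suc (suc k) / 2 ≡ suc (k / 2)
    half-suc-suc = m/n≡1+[m∸n]/n {suc (suc k)} (s≤s (s≤s z≤n))

  Aʳ-evenCoupling zero    = constant-coupling (1ℚ + q) 1ℚ (1ℚ - q) 1ℚ
  Aʳ-evenCoupling (suc k) = odd→even q (Aʳ-oddCoupling k)

theorem3p1 : (n : ℕ) → n ≥ 1 → (p q : ℚ) → (h : 1ℚ + p * q ≢ 0ℚ) →
    Ã n p q ≡ ((1ℚ + p * q) ^ (n / 2))
      * A n (_÷_ (p + q) (1ℚ + p * q) {{≢-nonZero h}}) 0ℚ
theorem3p1 (suc k) _ p q h = begin
  Ã (suc k) p q                                       ≡⟨ Ã≡Ã-factor*A (suc k) ⟩
  Ã-factor (suc k) * A (suc k) p q                    ≡⟨ cong (Ã-factor (suc k) *_) (A≡∑Aʳ k p q) ⟩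
  Ã-factor (suc k) * ∑ (suc k) (Aʳ p q k)             ≡⟨ Coupling-∑ (Aʳ-oddCoupling k) ⟩
  (1ℚ + p * q) ^ (suc k / 2) * ∑ (suc k) (Aʳ t 0ℚ k)  ≡⟨ cong ((1ℚ + p * q) ^ (suc k / 2) *_) (A≡∑Aʳ k t 0ℚ) ⟨
  (1ℚ + p * q) ^ (suc k / 2) * A (suc k) t 0ℚ         ∎
  where open Couplings p q h
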